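{- Let $\mathcal{M}$ be a simple oriented matroid on $E_m=\{1,\dots,m\}$ with covector set $\mathcal{L}$ and tope set $\mathcal{T}$. Let $\boldsymbol{R}=(T^0,T^1,\dots,T^{2m-1},T^0)$ be a symmetric cycle in the tope graph of $\mathcal{M}$ that does not contain the positive tope $(+\cdots+)$, and let $\mathcal{B}:=\mathrm{max}^+(\{T^0,\dots,T^{2m-1}\})$. Then for every $e\in E_m$, $$|\{T\in\mathcal{B}: T(e)=+\}|=\left\lceil \tfrac{|\mathcal{B}|}{2}\right\rceil.$$
   Context: Standing assumption: oriented matroids have rank at least $2$. An oriented matroid on $E$ is given by its covector set $\mathcal{L}\subseteq\{ -,0,+\}^E$; topes are covectors of inclusion-maximal support; $X^+:=\{e:X(e)=+\}$; $\mathbf{S}(X,Y):=\{e:X(e)=-Y(e)\ne0\}$. Simple: no loops, no parallel and no antiparallel elements. The tope graph has the topes as vertices, two topes adjacent iff they cover a common subtope (element of rank $r-1$) in the covector face lattice; for simple oriented matroids this means $|\mathbf{S}(T,T')|=1$. A cycle $(T^0,\dots,T^{2m-1},T^0)$ in the tope graph ($m=|E|$) is symmetric if $T^{k+m}=-T^k$ for $0\le k\le m-1$. For a set $\mathcal{P}$ of sign vectors, $\mathrm{max}^+(\mathcal{P})$ is the set of $P\in\mathcal{P}$ whose positive part is inclusion-maximal in $\{R^+:R\in\mathcal{P}\}$. -}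

module Defs where

open import Data.Nat using (ℕ; zero; suc; _+_; _*_; _<_)
open import Data.Fin using (Fin)
open import Data.Bool using (Bool; true; false; _∧_; _∨_; not; if_then_else_)
open import Data.List using (List; []; _∷_; allFin; upTo)
open import Data.Product using (Σ; _×_; ∃; ∃-syntax)
open import Data.Sum using (_⊎_)
open import Relation.Binary.PropositionalEquality using (_≡_; _≢_)
open import Relation.Nullary using (¬_)

data Sign : Set where
  ⊖ ◯ ⊕ : Sign

SignVec : ℕ → Set
SignVec m = Fin m → Sign

negS : Sign → Sign
negS ⊖ = ⊕
negS ◯ = ◯
negS ⊕ = ⊖

neg : ∀ {m} → SignVec m → SignVec m
neg X e = negS (X e)

zeroV : ∀ {m} → SignVec m
zeroV _ = ◯

plusV : ∀ {m} → SignVec m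
plusV _ = ⊕

_∘ₛ_ : ∀ {m} → SignVec m → SignVec m → SignVec m
(X ∘ₛ Y) e with X e
... | ◯ = Y e
... | s = s

Sep : ∀ {m} → SignVec m → SignVec m → Fin m → Set
Sep X Y e = (X e ≡ negS (Y e)) × (X e ≢ ◯)

record IsOM (m : ℕ) (L : SignVec m → Set) : Set where
  field
    L0 : L zeroV
    L1 : ∀ X → L X → L (neg X)
    L2 : ∀ X Y → L X → L Y → L (X ∘ₛ Y)
    L3 : ∀ X Y e → L X → L Y → Sep X Y e →
         Σ (SignVec m) λ Z → L Z × (Z e ≡ ◯) ×
           (∀ f → ¬ Sep X Y f → Z f ≡ (X ∘ₛ Y) f)

_≼_ : ∀ {m} → SignVec m → SignVec m → Set
X ≼ Y = ∀ e → (X e ≡ ◯) ⊎ (X e ≡ Y e)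

_≺_ : ∀ {m} → SignVec m → SignVec m → Set
X ≺ Y = (X ≼ Y) × (X ≢ Y)

RankAtLeast2 : ∀ {m} → (SignVec m → Set) → Set
RankAtLeast2 {m} L = Σ (SignVec m) λ X → Σ (SignVec m) λ Y →
  L X × L Y × (zeroV ≺ X) × (X ≺ Y)

Simple : ∀ {m} → (SignVec m → Set) → Set
Simple {m} L =
  (∀ e → Σ (SignVec m) λ X → L X × (X e ≢ ◯)) ×
  (∀ e f → e ≢ f →
     ¬ (∀ X → L X → X e ≡ X f) × ¬ (∀ X → L X → X e ≡ negS (X f)))

supp⊆ : ∀ {m} → SignVec m → SignVec m → Set
supp⊆ X Y = ∀ e → X e ≢ ◯ → Y e ≢ ◯

IsTope : ∀ {m} → (SignVec m → Set) → SignVec m → Set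
IsTope {m} L T = L T × (∀ Y → L Y → supp⊆ T Y → supp⊆ Y T)

Covers : ∀ {m} → (SignVec m → Set) → SignVec m → SignVec m → Set
Covers {m} L X T = (X ≺ T) × (¬ Σ (SignVec m) λ Y → L Y × (X ≺ Y) × (Y ≺ T))

IsSubtope : ∀ {m} → (SignVec m → Set) → SignVec m → Set
IsSubtope {m} L X = L X × Σ (SignVec m) λ T → IsTope L T × Covers L X T

Adjacent : ∀ {m} → (SignVec m → Set) → SignVec m → SignVec m → Set
Adjacent {m} L T T' = IsTope L T × IsTope L T' × (T ≢ T') ×
  Σ (SignVec m) λ X → IsSubtope L X × Covers L X T × Covers L X T'

-- symmetric cycle (R 0, ..., R (2m-1), R 0) in the tope graph, given as
-- R : ℕ → SignVec m whose values at indices ≥ 2m are irrelevant except R (2m) = R 0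
SymmetricCycle : ∀ m → (SignVec m → Set) → (ℕ → SignVec m) → Set
SymmetricCycle m L R =
  (∀ k → k < 2 * m → IsTope L (R k)) ×
  (∀ k → k < 2 * m → Adjacent L (R k) (R (suc k))) ×
  (R (2 * m) ≡ R 0) ×
  (∀ k l → k < 2 * m → l < 2 * m → R k ≡ R l → k ≡ l) ×
  (∀ k → k < m → R (k + m) ≡ neg (R k))

allB : {A : Set} → (A → Bool) → List A → Bool
allB p [] = true
allB p (x ∷ xs) = p x ∧ allB p xs

isPlus : Sign → Bool
isPlus ⊕ = true
isPlus _ = false

posSub : ∀ {m} → SignVec m → SignVec m → Bool
posSub {m} X Y = allB (λ e → not (isPlus (X e)) ∨ isPlus (Y e)) (allFin m)

inMaxPlus : ∀ m → (ℕ → SignVec m) → ℕ → Bool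
inMaxPlus m R k =
  allB (λ j → not (posSub (R k) (R j)) ∨ posSub (R j) (R k)) (upTo (2 * m))

count : {A : Set} → (A → Bool) → List A → ℕ
count p [] = 0
count p (x ∷ xs) = if p x then suc (count p xs) else count p xs

-- |B| (the R k, k < 2m, are pairwise distinct, so counting indices counts elements)
sizeB : ∀ m → (ℕ → SignVec m) → ℕ
sizeB m R = count (inMaxPlus m R) (upTo (2 * m))

sizeBplus : ∀ m → (ℕ → SignVec m) → Fin m → ℕ
sizeBplus m R e = count (λ k → inMaxPlus m R k ∧ isPlus (R k e)) (upTo (2 * m))

-- Consecutive topes of the cycle differ in exactly one element, since a subtope of a simple
-- oriented matroid has a single zero. The number of elements in which the tope k + s differs
-- from the tope k grows by at most one per step and reaches m at the antipode s = m, so it equals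
-- s: every element is flipped exactly once in any m consecutive steps. Call a step raising if it
-- flips its element to +. A tope of the cycle then lies in max⁺ exactly when it is a peak,
-- entered by a raising step and left by a lowering one. Fix e. It is + on an arc of m topes that
-- is entered by a raising step (of e) and left by a lowering one, so along the arc there is one
-- more peak than valley; and the antipodal map sends the peaks off the arc onto the valleys on
-- it. Hence |B| = 2v + 1 while v + 1 peaks have T(e) = +.

module Submission where

open import Defs
open import Data.Nat using (ℕ; _<_; _*_; ⌈_/2⌉)
open import Data.Fin using (Fin)
open import Relation.Binary.PropositionalEquality using (_≡_; _≢_)

open import Data.Bool using (Bool; true; false; _∧_; _∨_; not)
open import Data.Bool.Properties using (not-involutive; ∧-zeroʳ; ¬-not)
open import Data.Empty using (⊥-elim)
open import Data.Fin using (zero; suc; toℕ; inject₁; fromℕ)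
open import Data.Fin.Properties as Fin using (toℕ<n; toℕ-inject₁; toℕ-fromℕ; any?)
open import Data.List using ([]; _∷_; applyUpTo; upTo; allFin)
open import Data.List.Membership.Propositional using (_∈_)
open import Data.List.Membership.Propositional.Properties using (∈-allFin; ∈-upTo⁺; ∈-upTo⁻)
open import Data.List.Relation.Unary.Any using (here; there)
open import Data.Nat using (zero; suc; _+_; _∸_; _≤_; z≤n; s≤s; NonZero; >-nonZero⁻¹)
open import Data.Nat.DivMod using (_%_; %-distribˡ-+; m%n%n≡m%n; m%n<n; m<n⇒m%n≡m; n%n≡0; [m+n]%n≡m%n)
open import Data.Nat.Induction using (<-wellFounded)
open import Data.Nat.Properties
open import Data.Nat.Tactic.RingSolver using (solve-∀)
open import Data.Product using (Σ; _×_; _,_; proj₁; proj₂; ∃)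
open import Data.Sum using (_⊎_; inj₁; inj₂)
open import Data.Vec.Functional using (Vector)
open import Function using (_∘_; _on_; id)
open import Induction.WellFounded using (Acc; acc)
open import Relation.Binary using (DecidableEquality)
import Relation.Binary.Construct.On as On
open import Relation.Binary.PropositionalEquality
  using (refl; sym; trans; cong; cong₂; cong-app; subst; module ≡-Reasoning)
open import Relation.Nullary using (¬_; Dec; yes; no; does; ¬?; _×-dec_)
open import Relation.Nullary.Decidable using (dec-true; dec-false; decidable-stable)
open import Algebra.Properties.CommutativeMonoid.Sum +-0-commutativeMonoid
  using (sum; sum-syntax; sum-cong-≗; ∑-distrib-+; sum-init-last)

_≟ₛ_ : DecidableEquality Sign
⊖ ≟ₛ ⊖ = yes refl
⊖ ≟ₛ ◯ = no λ ()
⊖ ≟ₛ ⊕ = no λ ()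
◯ ≟ₛ ⊖ = no λ ()
◯ ≟ₛ ◯ = yes refl
◯ ≟ₛ ⊕ = no λ ()
⊕ ≟ₛ ⊖ = no λ ()
⊕ ≟ₛ ◯ = no λ ()
⊕ ≟ₛ ⊕ = yes refl

⊕≢⊖ : ⊕ ≢ ⊖
⊕≢⊖ ()

negS-involutive : ∀ x → negS (negS x) ≡ x
negS-involutive ⊖ = refl
negS-involutive ◯ = refl
negS-involutive ⊕ = refl

negS-injective : ∀ {x y} → negS x ≡ negS y → x ≡ y
negS-injective {x} {y} eq =
  trans (sym (negS-involutive x)) (trans (cong negS eq) (negS-involutive y))

negS-≢ : ∀ {x} → x ≢ ◯ → negS x ≢ x
negS-≢ {◯} x≢◯ _ = x≢◯ refl

≡-or-opposite : ∀ {x y} → x ≢ ◯ → y ≢ ◯ → x ≡ y ⊎ x ≡ negS y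
≡-or-opposite {⊖} {⊖} _ _ = inj₁ refl
≡-or-opposite {⊖} {⊕} _ _ = inj₂ refl
≡-or-opposite {⊕} {⊖} _ _ = inj₂ refl
≡-or-opposite {⊕} {⊕} _ _ = inj₁ refl
≡-or-opposite {◯} x≢◯ _ = ⊥-elim (x≢◯ refl)
≡-or-opposite {y = ◯} _ y≢◯ = ⊥-elim (y≢◯ refl)

≢⇒opposite : ∀ {x y} → x ≢ ◯ → y ≢ ◯ → x ≢ y → x ≡ negS y
≢⇒opposite x≢◯ y≢◯ x≢y with ≡-or-opposite x≢◯ y≢◯
... | inj₁ x≡y = ⊥-elim (x≢y x≡y)
... | inj₂ x≡-y = x≡-y

isPlus-negS : ∀ {x} → x ≢ ◯ → isPlus (negS x) ≡ not (isPlus x)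
isPlus-negS {⊖} _ = refl
isPlus-negS {◯} x≢◯ = ⊥-elim (x≢◯ refl)
isPlus-negS {⊕} _ = refl

isPlus⇒≡⊕ : ∀ {x} → isPlus x ≡ true → x ≡ ⊕
isPlus⇒≡⊕ {⊕} _ = refl

¬isPlus⇒≡⊖ : ∀ {x} → x ≢ ◯ → isPlus x ≡ false → x ≡ ⊖
¬isPlus⇒≡⊖ {⊖} _ _ = refl
¬isPlus⇒≡⊖ {◯} x≢◯ _ = ⊥-elim (x≢◯ refl)

unopposed : ∀ {x y} → y ≢ ◯ → ¬ (x ≡ negS y × x ≢ ◯) → x ≡ ◯ ⊎ x ≡ y
unopposed {◯} _ _ = inj₁ refl
unopposed {⊖} {⊖} _ _ = inj₂ refl
unopposed {⊕} {⊕} _ _ = inj₂ refl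
unopposed {⊖} {⊕} _ ¬opp = ⊥-elim (¬opp (refl , λ ()))
unopposed {⊕} {⊖} _ ¬opp = ⊥-elim (¬opp (refl , λ ()))
unopposed {⊖} {◯} y≢◯ _ = ⊥-elim (y≢◯ refl)
unopposed {⊕} {◯} y≢◯ _ = ⊥-elim (y≢◯ refl)

≡⇒unopposed : ∀ {x y} → x ≡ y → ¬ (x ≡ negS y × x ≢ ◯)
≡⇒unopposed refl (x≡-x , x≢◯) = negS-≢ x≢◯ (sym x≡-x)

∘ₛ-◯ : ∀ {m} (X Y : SignVec m) {e} → X e ≡ ◯ → (X ∘ₛ Y) e ≡ Y e
∘ₛ-◯ X Y {e} Xe≡◯ with X e
... | ◯ = refl

∘ₛ-≢◯ : ∀ {m} (X Y : SignVec m) {e} → X e ≢ ◯ → (X ∘ₛ Y) e ≡ X e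
∘ₛ-≢◯ X Y {e} Xe≢◯ with X e
... | ⊖ = refl
... | ◯ = ⊥-elim (Xe≢◯ refl)
... | ⊕ = refl

≼-∘ₛ : ∀ {m} (X Y : SignVec m) → X ≼ (X ∘ₛ Y)
≼-∘ₛ X Y f with X f ≟ₛ ◯
... | yes Xf≡◯ = inj₁ Xf≡◯
... | no Xf≢◯ = inj₂ (sym (∘ₛ-≢◯ X Y Xf≢◯))

≼-≢◯ : ∀ {m} {X Y : SignVec m} → X ≼ Y → ∀ {f} → X f ≢ ◯ → X f ≡ Y f
≼-≢◯ X≼Y {f} Xf≢◯ with X≼Y f
... | inj₁ Xf≡◯ = ⊥-elim (Xf≢◯ Xf≡◯)
... | inj₂ Xf≡Yf = Xf≡Yf

≼-common-◯ : ∀ {m} {X Y Y' : SignVec m} → X ≼ Y → X ≼ Y' → ∀ {f} → Y f ≢ Y' f → X f ≡ ◯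
≼-common-◯ X≼Y X≼Y' {f} Yf≢Y'f with X≼Y f | X≼Y' f
... | inj₁ Xf≡◯ | _ = Xf≡◯
... | inj₂ _ | inj₁ Xf≡◯ = Xf≡◯
... | inj₂ Xf≡Yf | inj₂ Xf≡Y'f = ⊥-elim (Yf≢Y'f (trans (sym Xf≡Yf) Xf≡Y'f))

_⊆⁺_ : ∀ {m} → SignVec m → SignVec m → Set
X ⊆⁺ Y = ∀ f → X f ≡ ⊕ → Y f ≡ ⊕

raising-one-entry : ∀ {m} {X Y : SignVec m} {g} → (∀ f → f ≢ g → Y f ≡ X f) → X g ≡ ⊖ → Y g ≡ ⊕ →
                    X ⊆⁺ Y × ¬ (Y ⊆⁺ X)
raising-one-entry {X = X} {Y} {g} Y≡X Xg≡⊖ Yg≡⊕ = X⊆⁺Y , λ Y⊆⁺X → ⊕≢⊖ (trans (sym (Y⊆⁺X g Yg≡⊕)) Xg≡⊖)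
  where
  X⊆⁺Y : X ⊆⁺ Y
  X⊆⁺Y f Xf≡⊕ with f Fin.≟ g
  ... | yes refl = Yg≡⊕
  ... | no f≢g = trans (Y≡X f f≢g) Xf≡⊕

_≠ₛ_ : Sign → Sign → Bool
x ≠ₛ y = not (does (x ≟ₛ y))

≠ₛ-false : ∀ {x y} → x ≡ y → (x ≠ₛ y) ≡ false
≠ₛ-false {x} {y} x≡y = cong not (dec-true (x ≟ₛ y) x≡y)

≠ₛ-true : ∀ {x y} → x ≢ y → (x ≠ₛ y) ≡ true
≠ₛ-true {x} {y} x≢y = cong not (dec-false (x ≟ₛ y) x≢y)

Sep? : ∀ {m} (X Y : SignVec m) e → Dec (Sep X Y e)
Sep? X Y e = (X e ≟ₛ negS (Y e)) ×-dec ¬? (X e ≟ₛ ◯)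

false≢true : false ≢ true
false≢true ()

not-∧-true : ∀ {a b} → not a ∧ b ≡ true → a ≡ false × b ≡ true
not-∧-true {false} {true} _ = refl , refl

implication⇒ : ∀ {a b} → not a ∨ b ≡ true → a ≡ true → b ≡ true
implication⇒ {true} a⇒b refl = a⇒b

⇒implication : ∀ {a b} → (a ≡ true → b ≡ true) → not a ∨ b ≡ true
⇒implication {false} _ = refl
⇒implication {true} a⇒b = a⇒b refl

discrete-ivt : ∀ (b : ℕ → Bool) d → b 0 ≡ false → b d ≡ true → ∃ λ k → not (b k) ∧ b (suc k) ≡ true
discrete-ivt b zero b0≡false b0≡true with () ← trans (sym b0≡false) b0≡true
discrete-ivt b (suc d) b0≡false bsd≡true with b d in bd
... | false = d , cong₂ (λ x y → not x ∧ y) bd bsd≡true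
... | true = discrete-ivt b d b0≡false bd

allB⇒∈ : ∀ {A : Set} (p : A → Bool) xs → allB p xs ≡ true → ∀ {x} → x ∈ xs → p x ≡ true
allB⇒∈ p (y ∷ ys) all∈ x∈ with p y in py
allB⇒∈ p (y ∷ ys) all∈ (here refl) | true = py
allB⇒∈ p (y ∷ ys) all∈ (there x∈) | true = allB⇒∈ p ys all∈ x∈

∈⇒allB : ∀ {A : Set} (p : A → Bool) xs → (∀ {x} → x ∈ xs → p x ≡ true) → allB p xs ≡ true
∈⇒allB p [] _ = refl
∈⇒allB p (y ∷ ys) all∈ = cong₂ _∧_ (all∈ (here refl)) (∈⇒allB p ys (all∈ ∘ there))

𝟙 : Bool → ℕ
𝟙 true = 1
𝟙 false = 0

𝟙≤1 : ∀ b → 𝟙 b ≤ 1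
𝟙≤1 true = ≤-refl
𝟙≤1 false = z≤n

𝟙-split : ∀ a c → 𝟙 a ≡ 𝟙 (a ∧ c) + 𝟙 (a ∧ not c)
𝟙-split true true = refl
𝟙-split true false = refl
𝟙-split false c = refl

𝟙-does-mono : ∀ {P Q : Set} (P? : Dec P) (Q? : Dec Q) → (P → Q) → 𝟙 (does P?) ≤ 𝟙 (does Q?)
𝟙-does-mono (no _) Q? _ = z≤n
𝟙-does-mono (yes p) (yes _) _ = ≤-refl
𝟙-does-mono (yes p) (no ¬q) P⇒Q = ⊥-elim (¬q (P⇒Q p))

𝟙-does-< : ∀ {P Q : Set} (P? : Dec P) (Q? : Dec Q) → ¬ P → Q → 𝟙 (does P?) < 𝟙 (does Q?)
𝟙-does-< P? Q? ¬p q rewrite dec-false P? ¬p | dec-true Q? q = s≤s z≤n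

telescope-step : ∀ u u′ p p′ → p′ ≡ p ⊎ u ≡ p′ →
                 𝟙 ((u ∧ not u′) ∧ p′) + 𝟙 (u′ ∧ p′) ≡ 𝟙 ((not u ∧ u′) ∧ p′) + 𝟙 (u ∧ p) + 𝟙 (not p ∧ p′)
telescope-step true  true  true  .true (inj₁ refl) = refl
telescope-step true  true  false .false (inj₁ refl) = refl
telescope-step true  false true  .true (inj₁ refl) = refl
telescope-step true  false false .false (inj₁ refl) = refl
telescope-step false true  true  .true (inj₁ refl) = refl
telescope-step false true  false .false (inj₁ refl) = refl
telescope-step false false true  .true (inj₁ refl) = refl
telescope-step false false false .false (inj₁ refl) = refl
telescope-step true  true  true  .true (inj₂ refl) = refl
telescope-step true  true  false .true (inj₂ refl) = refl
telescope-step true  false true  .true (inj₂ refl) = refl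
telescope-step true  false false .true (inj₂ refl) = refl
telescope-step false true  true  .false (inj₂ refl) = refl
telescope-step false true  false .false (inj₂ refl) = refl
telescope-step false false true  .false (inj₂ refl) = refl
telescope-step false false false .false (inj₂ refl) = refl

∑-mono-≤ : ∀ {n} {f g : Vector ℕ n} → (∀ i → f i ≤ g i) → sum f ≤ sum g
∑-mono-≤ {zero} f≤g = z≤n
∑-mono-≤ {suc n} f≤g = +-mono-≤ (f≤g zero) (∑-mono-≤ (f≤g ∘ suc))

∑-mono-< : ∀ {n} {f g : Vector ℕ n} (j : Fin n) → (∀ i → f i ≤ g i) → f j < g j → sum f < sum g
∑-mono-< zero f≤g fj<gj = +-mono-<-≤ fj<gj (∑-mono-≤ (f≤g ∘ suc))
∑-mono-< (suc j) f≤g fj<gj = +-mono-≤-< (f≤g zero) (∑-mono-< j (f≤g ∘ suc) fj<gj)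

∑-update : ∀ {n} {f g : Vector ℕ n} (j : Fin n) → (∀ i → i ≢ j → f i ≡ g i) →
           sum f + g j ≡ sum g + f j
∑-update {f = f} {g} zero f≡g = begin
  f zero + sum (f ∘ suc) + g zero ≡⟨ cong (λ s → f zero + s + g zero) (sum-cong-≗ (λ i → f≡g (suc i) λ ())) ⟩
  f zero + sum (g ∘ suc) + g zero ≡⟨ swap-ends (f zero) (sum (g ∘ suc)) (g zero) ⟩
  g zero + sum (g ∘ suc) + f zero ∎
  where
  open ≡-Reasoning
  swap-ends : ∀ a b c → a + b + c ≡ c + b + a
  swap-ends = solve-∀
∑-update {f = f} {g} (suc j) f≡g = begin
  f zero + sum (f ∘ suc) + g (suc j)   ≡⟨ +-assoc (f zero) _ _ ⟩
  f zero + (sum (f ∘ suc) + g (suc j)) ≡⟨ cong₂ _+_ (f≡g zero λ ()) (∑-update j λ i i≢j → f≡g (suc i) (i≢j ∘ Fin.suc-injective)) ⟩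
  g zero + (sum (g ∘ suc) + f (suc j)) ≡⟨ +-assoc (g zero) _ _ ⟨
  g zero + sum (g ∘ suc) + f (suc j)   ∎
  where open ≡-Reasoning

∑-𝟙-all : ∀ {n} {b : Vector Bool n} → (∀ i → b i ≡ true) → ∑[ i < n ] 𝟙 (b i) ≡ n
∑-𝟙-all {zero} _ = refl
∑-𝟙-all {suc n} {b} all rewrite all zero = cong suc (∑-𝟙-all (all ∘ suc))

∑-𝟙-none : ∀ {n} {b : Vector Bool n} → (∀ i → b i ≡ false) → ∑[ i < n ] 𝟙 (b i) ≡ 0
∑-𝟙-none {zero} _ = refl
∑-𝟙-none {suc n} {b} none rewrite none zero = ∑-𝟙-none (none ∘ suc)

sumUpTo : ℕ → (ℕ → ℕ) → ℕ
sumUpTo n f = ∑[ i < n ] f (toℕ i)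

count-applyUpTo : ∀ (b : ℕ → Bool) f n → count b (applyUpTo f n) ≡ sumUpTo n (𝟙 ∘ b ∘ f)
count-applyUpTo b f zero = refl
count-applyUpTo b f (suc n) with b (f 0)
... | true = cong suc (count-applyUpTo b (f ∘ suc) n)
... | false = count-applyUpTo b (f ∘ suc) n

sumUpTo-cong : ∀ n {f g} → (∀ k → k < n → f k ≡ g k) → sumUpTo n f ≡ sumUpTo n g
sumUpTo-cong n f≡g = sum-cong-≗ (λ i → f≡g (toℕ i) (toℕ<n i))

sumUpTo-distrib-+ : ∀ n f g → sumUpTo n (λ k → f k + g k) ≡ sumUpTo n f + sumUpTo n g
sumUpTo-distrib-+ n f g = ∑-distrib-+ {n} (f ∘ toℕ) (g ∘ toℕ)

sumUpTo-𝟙-none : ∀ {n} {b : ℕ → Bool} → (∀ k → k < n → b k ≡ false) → sumUpTo n (𝟙 ∘ b) ≡ 0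
sumUpTo-𝟙-none none = ∑-𝟙-none (λ i → none (toℕ i) (toℕ<n i))

sumUpTo-𝟙-single : ∀ n (b : ℕ → Bool) → 0 < n → b 0 ≡ true → (∀ t → suc t < n → b (suc t) ≡ false) →
                   sumUpTo n (𝟙 ∘ b) ≡ 1
sumUpTo-𝟙-single (suc n) b _ b₀ rest =
  cong₂ _+_ (cong 𝟙 b₀) (sumUpTo-𝟙-none (λ t t<n → rest t (s≤s t<n)))

sumUpTo-rotate : ∀ n f → f n ≡ f 0 → sumUpTo n (f ∘ suc) ≡ sumUpTo n f
sumUpTo-rotate n f fn≡f0 = +-cancelˡ-≡ (f 0) _ _ (begin
  f 0 + sumUpTo n (f ∘ suc)                       ≡⟨ sum-init-last {n} (f ∘ toℕ) ⟩
  ∑[ i < n ] f (toℕ (inject₁ i)) + f (toℕ (fromℕ n)) ≡⟨ cong₂ _+_ (sum-cong-≗ {n} (cong f ∘ toℕ-inject₁))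
                                                                 (trans (cong f (toℕ-fromℕ n)) fn≡f0) ⟩
  sumUpTo n f + f 0                               ≡⟨ +-comm _ (f 0) ⟩
  f 0 + sumUpTo n f                               ∎)
  where open ≡-Reasoning

sumUpTo-shift : ∀ n f → (∀ k → f (k + n) ≡ f k) → ∀ c → sumUpTo n (λ k → f (k + c)) ≡ sumUpTo n f
sumUpTo-shift n f periodic zero = sumUpTo-cong n (λ k _ → cong f (+-identityʳ k))
sumUpTo-shift n f periodic (suc c) = begin
  sumUpTo n (λ k → f (k + suc c))   ≡⟨ sumUpTo-cong n (λ k _ → cong f (+-suc k c)) ⟩
  sumUpTo n (λ k → f (suc k + c))   ≡⟨ sumUpTo-rotate n (λ k → f (k + c))
                                                      (trans (cong f (+-comm n c)) (periodic c)) ⟩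
  sumUpTo n (λ k → f (k + c))       ≡⟨ sumUpTo-shift n f periodic c ⟩
  sumUpTo n f                       ∎
  where open ≡-Reasoning

2*m≡m+m : ∀ m → 2 * m ≡ m + m
2*m≡m+m m = cong (m +_) (+-identityʳ m)

[m+n%d]%d≡[m+n]%d : ∀ a b d .{{_ : NonZero d}} → (a + b % d) % d ≡ (a + b) % d
[m+n%d]%d≡[m+n]%d a b d = begin
  (a + b % d) % d          ≡⟨ %-distribˡ-+ a (b % d) d ⟩
  (a % d + b % d % d) % d  ≡⟨ cong (λ x → (a % d + x) % d) (m%n%n≡m%n b d) ⟩
  (a % d + b % d) % d      ≡⟨ %-distribˡ-+ a b d ⟨
  (a + b) % d              ∎
  where open ≡-Reasoning

[m%d+n]%d≡[m+n]%d : ∀ a b d .{{_ : NonZero d}} → (a % d + b) % d ≡ (a + b) % d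
[m%d+n]%d≡[m+n]%d a b d = begin
  (a % d + b) % d          ≡⟨ cong (_% d) (+-comm (a % d) b) ⟩
  (b + a % d) % d          ≡⟨ [m+n%d]%d≡[m+n]%d b a d ⟩
  (b + a) % d              ≡⟨ cong (_% d) (+-comm b a) ⟩
  (a + b) % d              ∎
  where open ≡-Reasoning

suc-%-suc : ∀ k d .{{_ : NonZero d}} → suc k % d ≡ suc (k % d) % d
suc-%-suc k d = sym ([m+n%d]%d≡[m+n]%d 1 k d)

cyclic-offset : ∀ n .{{_ : NonZero n}} c j → j < n → ∃ λ t → t < n × (t + c) % n ≡ j
cyclic-offset n c j j<n = (j + (n ∸ c % n)) % n , m%n<n _ n , (begin
  ((j + (n ∸ c % n)) % n + c) % n   ≡⟨ [m%d+n]%d≡[m+n]%d _ c n ⟩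
  (j + (n ∸ c % n) + c) % n          ≡⟨ [m+n%d]%d≡[m+n]%d (j + (n ∸ c % n)) c n ⟨
  (j + (n ∸ c % n) + c % n) % n      ≡⟨ cong (_% n) (trans (+-assoc j _ _)
                                                            (cong (j +_) (m∸n+n≡m (<⇒≤ (m%n<n c n))))) ⟩
  (j + n) % n                         ≡⟨ [m+n]%n≡m%n j n ⟩
  j % n                               ≡⟨ m<n⇒m%n≡m j<n ⟩
  j                                   ∎)
  where open ≡-Reasoning

sumUpTo-rotate-% : ∀ n .{{_ : NonZero n}} H → sumUpTo n H ≡ sumUpTo n (λ k → H (suc k % n))
sumUpTo-rotate-% n H = begin
  sumUpTo n H                        ≡⟨ sumUpTo-cong n (λ k k<n → cong H (m<n⇒m%n≡m k<n)) ⟨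
  sumUpTo n (λ k → H (k % n))        ≡⟨ sumUpTo-rotate n (λ k → H (k % n)) (cong H n%n≡0%n) ⟨
  sumUpTo n (λ k → H (suc k % n))    ∎
  where
  open ≡-Reasoning
  n%n≡0%n : n % n ≡ 0 % n
  n%n≡0%n = trans (n%n≡0 n) (sym (m<n⇒m%n≡m (>-nonZero⁻¹ n)))

-- Positive parts and max⁺

posSub⇒⊆⁺ : ∀ {m} {X Y : SignVec m} → posSub X Y ≡ true → X ⊆⁺ Y
posSub⇒⊆⁺ {m} X⊆Y f Xf≡⊕ =
  isPlus⇒≡⊕ (implication⇒ (allB⇒∈ _ (allFin m) X⊆Y (∈-allFin f)) (cong isPlus Xf≡⊕))

⊆⁺⇒posSub : ∀ {m} {X Y : SignVec m} → X ⊆⁺ Y → posSub X Y ≡ true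
⊆⁺⇒posSub {m} X⊆Y = ∈⇒allB _ (allFin m) λ {f} _ → ⇒implication (cong isPlus ∘ X⊆Y f ∘ isPlus⇒≡⊕)

inMaxPlus-true : ∀ m (R : ℕ → SignVec m) i → (∀ j → j < 2 * m → R i ⊆⁺ R j → R j ⊆⁺ R i) →
                 inMaxPlus m R i ≡ true
inMaxPlus-true m R i maximal = ∈⇒allB _ (upTo (2 * m)) λ {j} j∈ →
  ⇒implication (⊆⁺⇒posSub ∘ maximal j (∈-upTo⁻ j∈) ∘ posSub⇒⊆⁺)

inMaxPlus-false : ∀ m (R : ℕ → SignVec m) i {j} → j < 2 * m → R i ⊆⁺ R j → ¬ (R j ⊆⁺ R i) →
                  inMaxPlus m R i ≡ false
inMaxPlus-false m R i j<n i⊆j j⊈i = ¬-not λ maximal →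
  j⊈i (posSub⇒⊆⁺ (implication⇒ (allB⇒∈ _ (upTo (2 * m)) maximal (∈-upTo⁺ j<n)) (⊆⁺⇒posSub i⊆j)))

-- Simple oriented matroids

module _ {m} {L : SignVec m → Set} (om : IsOM m L) (simple : Simple L) where
  open IsOM om

  tope-nonzero : ∀ {T} → IsTope L T → ∀ e → T e ≢ ◯
  tope-nonzero {T} (LT , maximal) e Te≡◯ with proj₁ simple e
  ... | X , LX , Xe≢◯ = maximal (T ∘ₛ X) (L2 T X LT LX) T⊆T∘X e T∘Xe≢◯ Te≡◯
    where
    T⊆T∘X : supp⊆ T (T ∘ₛ X)
    T⊆T∘X f Tf≢◯ eq = Tf≢◯ (trans (sym (∘ₛ-≢◯ T X Tf≢◯)) eq)
    T∘Xe≢◯ : (T ∘ₛ X) e ≢ ◯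
    T∘Xe≢◯ eq = Xe≢◯ (trans (sym (∘ₛ-◯ T X Te≡◯)) eq)

  module _ {X T} (LX : L X) (tope : IsTope L T) (X⋖T : Covers L X T) where
    private
      T≢◯ = tope-nonzero tope

    separations : SignVec m → ℕ
    separations V = ∑[ f < m ] 𝟙 (does (Sep? V T f))

    unseparated-agrees : ∀ {V h} → L V → X ≼ V → X h ≡ ◯ → V h ≡ T h →
                         (∀ f → ¬ Sep V T f) → ∀ f → V f ≡ T f
    unseparated-agrees {V} {h} LV X≼V Xh≡◯ Vh≡Th unsep f with V f ≟ₛ T f
    ... | yes Vf≡Tf = Vf≡Tf
    ... | no Vf≢Tf = ⊥-elim (proj₂ X⋖T (V , LV , (X≼V , X≢V) , (V≼T , V≢T)))
      where
      X≢V : X ≢ V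
      X≢V X≡V = T≢◯ h (trans (sym Vh≡Th) (trans (sym (cong-app X≡V h)) Xh≡◯))
      V≼T : V ≼ T
      V≼T g = unopposed (T≢◯ g) (unsep g)
      V≢T : V ≢ T
      V≢T V≡T = Vf≢Tf (cong-app V≡T f)

    eliminate-separation : ∀ {V h g} → L V → X ≼ V → V h ≡ T h → Sep V T g →
                Σ (SignVec m) λ Z → L Z × X ≼ Z × Z h ≡ T h × Z g ≡ ◯ × separations Z < separations V
    eliminate-separation {V} {h} {g} LV X≼V Vh≡Th sepg with L3 V T g LV (proj₁ tope) sepg
    ... | Z , LZ , Zg≡◯ , Z≡V∘T =
      Z , LZ , X≼Z , Z≡T (≡⇒unopposed Vh≡Th) , Zg≡◯ ,
      ∑-mono-< g (λ f → 𝟙-does-mono (Sep? Z T f) (Sep? V T f) (sepZ⇒sepV f))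
                 (𝟙-does-< (Sep? Z T g) (Sep? V T g) (λ (_ , Zg≢◯) → Zg≢◯ Zg≡◯) sepg)
      where
      Z≡T : ∀ {f} → ¬ Sep V T f → Z f ≡ T f
      Z≡T {f} unsep with unopposed (T≢◯ f) unsep
      ... | inj₁ Vf≡◯ = trans (Z≡V∘T f unsep) (∘ₛ-◯ V T Vf≡◯)
      ... | inj₂ Vf≡Tf = trans (Z≡V∘T f unsep)
                           (trans (∘ₛ-≢◯ V T (λ Vf≡◯ → T≢◯ f (trans (sym Vf≡Tf) Vf≡◯))) Vf≡Tf)
      X≼Z : X ≼ Z
      X≼Z f with X f ≟ₛ ◯
      ... | yes Xf≡◯ = inj₁ Xf≡◯
      ... | no Xf≢◯ = inj₂ (trans Xf≡Tf (sym (Z≡T (≡⇒unopposed (trans (sym (≼-≢◯ X≼V Xf≢◯)) Xf≡Tf)))))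
        where Xf≡Tf = ≼-≢◯ (proj₁ (proj₁ X⋖T)) Xf≢◯
      sepZ⇒sepV : ∀ f → Sep Z T f → Sep V T f
      sepZ⇒sepV f sepZ with Sep? V T f
      ... | yes sepV = sepV
      ... | no unsep = ⊥-elim (≡⇒unopposed (Z≡T unsep) sepZ)

    -- Induction on the number of separations from T: eliminating one of them gives a covector
    -- that still lies above X and agrees with T at h, but vanishes where T does not.
    agrees-above : ∀ {V h} → Acc (_<_ on separations) V → L V → X ≼ V → X h ≡ ◯ → V h ≡ T h →
                   ∀ f → V f ≡ T f
    agrees-above {V} (acc rec) LV X≼V Xh≡◯ Vh≡Th with any? (Sep? V T)
    ... | no unsep = unseparated-agrees LV X≼V Xh≡◯ Vh≡Th (λ f sep → unsep (f , sep))
    ... | yes (g , sepg) with eliminate-separation LV X≼V Vh≡Th sepg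
    ... | Z , LZ , X≼Z , Zh≡Th , Zg≡◯ , fewer =
      ⊥-elim (T≢◯ g (trans (sym (agrees-above (rec fewer) LZ X≼Z Xh≡◯ Zh≡Th g)) Zg≡◯))

    zeros-agree : ∀ {Y h} → L Y → X h ≡ ◯ → Y h ≡ T h → ∀ {f} → X f ≡ ◯ → Y f ≡ T f
    zeros-agree {Y} LY Xh≡◯ Yh≡Th {f} Xf≡◯ =
      trans (sym (∘ₛ-◯ X Y Xf≡◯))
            (agrees-above (On.wellFounded separations <-wellFounded (X ∘ₛ Y)) (L2 X Y LX LY) (≼-∘ₛ X Y)
                          Xh≡◯ (trans (∘ₛ-◯ X Y Xh≡◯) Yh≡Th) f)

    zeros-aligned : ∀ {Y h} → L Y → X h ≡ ◯ → Y h ≢ ◯ →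
                    (∀ {f} → X f ≡ ◯ → Y f ≡ T f) ⊎ (∀ {f} → X f ≡ ◯ → Y f ≡ negS (T f))
    zeros-aligned {Y} {h} LY Xh≡◯ Yh≢◯ with ≡-or-opposite Yh≢◯ (T≢◯ h)
    ... | inj₁ Yh≡Th = inj₁ (zeros-agree LY Xh≡◯ Yh≡Th)
    ... | inj₂ Yh≡-Th = inj₂ λ {f} Xf≡◯ →
      trans (sym (negS-involutive (Y f)))
            (cong negS (zeros-agree (L1 Y LY) Xh≡◯ (trans (cong negS Yh≡-Th) (negS-involutive (T h))) Xf≡◯))

    zeros-nonzero : ∀ {Y e f} → L Y → X e ≡ ◯ → X f ≡ ◯ → Y e ≢ ◯ → Y f ≢ ◯
    zeros-nonzero {f = f} LY Xe≡◯ Xf≡◯ Ye≢◯ Yf≡◯ with zeros-aligned LY Xe≡◯ Ye≢◯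
    ... | inj₁ agree = T≢◯ f (trans (sym (agree Xf≡◯)) Yf≡◯)
    ... | inj₂ oppose = T≢◯ f (negS-injective (trans (sym (oppose Xf≡◯)) Yf≡◯))

    -- With σ = id or σ = negS this makes e and f parallel or antiparallel.
    zeros-related : ∀ {e f} (σ : Sign → Sign) → σ ◯ ≡ ◯ → (∀ x → σ (negS x) ≡ negS (σ x)) →
                    X e ≡ ◯ → X f ≡ ◯ → T e ≡ σ (T f) → ∀ Y → L Y → Y e ≡ σ (Y f)
    zeros-related {e} {f} σ σ◯ σ-negS Xe≡◯ Xf≡◯ Te≡σTf Y LY with Y f ≟ₛ ◯
    ... | no Yf≢◯ with zeros-aligned LY Xf≡◯ Yf≢◯
    ...   | inj₁ agree = begin
            Y e       ≡⟨ agree Xe≡◯ ⟩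
            T e       ≡⟨ Te≡σTf ⟩
            σ (T f)   ≡⟨ cong σ (agree Xf≡◯) ⟨
            σ (Y f)   ∎
      where open ≡-Reasoning
    ...   | inj₂ oppose = begin
            Y e              ≡⟨ oppose Xe≡◯ ⟩
            negS (T e)       ≡⟨ cong negS Te≡σTf ⟩
            negS (σ (T f))   ≡⟨ σ-negS (T f) ⟨
            σ (negS (T f))   ≡⟨ cong σ (oppose Xf≡◯) ⟨
            σ (Y f)          ∎
      where open ≡-Reasoning
    zeros-related {e} {f} σ σ◯ σ-negS Xe≡◯ Xf≡◯ Te≡σTf Y LY | yes Yf≡◯ with Y e ≟ₛ ◯
    ... | yes Ye≡◯ = trans Ye≡◯ (trans (sym σ◯) (cong σ (sym Yf≡◯)))
    ... | no Ye≢◯ = ⊥-elim (zeros-nonzero LY Xe≡◯ Xf≡◯ Ye≢◯ Yf≡◯)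

    single-zero : ∀ {e f} → X e ≡ ◯ → X f ≡ ◯ → e ≡ f
    single-zero {e} {f} Xe≡◯ Xf≡◯ with e Fin.≟ f
    ... | yes e≡f = e≡f
    ... | no e≢f with ≡-or-opposite (T≢◯ e) (T≢◯ f)
    ...   | inj₁ Te≡Tf = ⊥-elim (proj₁ (proj₂ simple e f e≢f)
                                (zeros-related (λ x → x) refl (λ _ → refl) Xe≡◯ Xf≡◯ Te≡Tf))
    ...   | inj₂ Te≡-Tf = ⊥-elim (proj₂ (proj₂ simple e f e≢f)
                                 (zeros-related negS refl (λ _ → refl) Xe≡◯ Xf≡◯ Te≡-Tf))

  adjacent-differ-once : ∀ {T T'} → Adjacent L T T' → ∀ {e f} → T e ≢ T' e → f ≢ e → T' f ≡ T f
  adjacent-differ-once (tope , _ , _ , X , (LX , _) , X⋖T , X⋖T') {e} {f} Te≢T'e f≢e =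
    trans (sym (≼-≢◯ X≼T' Xf≢◯)) (≼-≢◯ X≼T Xf≢◯)
    where
    X≼T = proj₁ (proj₁ X⋖T)
    X≼T' = proj₁ (proj₁ X⋖T')
    Xf≢◯ : X f ≢ ◯
    Xf≢◯ Xf≡◯ = f≢e (single-zero LX tope X⋖T Xf≡◯ (≼-common-◯ X≼T X≼T' Te≢T'e))

-- Antipodal walks

module AntipodalWalk {m} {{_ : NonZero m}} (Q : ℕ → SignVec m)
  (Q-nonzero : ∀ k f → Q k f ≢ ◯)
  (Q-local : ∀ k {e f} → Q k e ≢ Q (suc k) e → f ≢ e → Q (suc k) f ≡ Q k f)
  (Q-antipodal : ∀ k f → Q (k + m) f ≡ negS (Q k f)) where

  n : ℕ
  n = 2 * m

  instance
    n≢0 : NonZero n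
    n≢0 = m*n≢0 2 m

  n≡m+m : n ≡ m + m
  n≡m+m = 2*m≡m+m m

  antipodal⇒periodic : ∀ {A : Set} {inv : A → A} → (∀ x → inv (inv x) ≡ x) →
                       (h : ℕ → A) → (∀ k → h (k + m) ≡ inv (h k)) → ∀ k → h (k + n) ≡ h k
  antipodal⇒periodic {inv = inv} involutive h antipodal k = begin
    h (k + n)            ≡⟨ cong h (trans (cong (k +_) n≡m+m) (sym (+-assoc k m m))) ⟩
    h (k + m + m)        ≡⟨ antipodal (k + m) ⟩
    inv (h (k + m))      ≡⟨ cong inv (antipodal k) ⟩
    inv (inv (h k))      ≡⟨ involutive (h k) ⟩
    h k                  ∎
    where open ≡-Reasoning

  distance : ℕ → ℕ → ℕ
  distance i s = ∑[ f < m ] 𝟙 (Q (s + i) f ≠ₛ Q i f)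

  distance-zero : ∀ i → distance i 0 ≡ 0
  distance-zero i = ∑-𝟙-none (λ f → ≠ₛ-false {Q i f} refl)

  distance-half : ∀ i → distance i m ≡ m
  distance-half i = ∑-𝟙-all (≠ₛ-true ∘ opposite)
    where
    opposite : ∀ f → Q (m + i) f ≢ Q i f
    opposite f eq = negS-≢ (Q-nonzero i f)
                      (trans (sym (Q-antipodal i f)) (trans (cong (λ j → Q j f) (+-comm i m)) eq))

  unchanged-or-flip : ∀ k → (∀ f → Q (suc k) f ≡ Q k f) ⊎ ∃ λ g → Q k g ≢ Q (suc k) g
  unchanged-or-flip k with any? (λ g → ¬? (Q k g ≟ₛ Q (suc k) g))
  ... | yes flip = inj₂ flip
  ... | no ¬flip = inj₁ λ f → decidable-stable (Q (suc k) f ≟ₛ Q k f) (λ ne → ¬flip (f , ne ∘ sym))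

  distance-update : ∀ i s {g} → (∀ f → f ≢ g → Q (suc s + i) f ≡ Q (s + i) f) →
                    distance i (suc s) + 𝟙 (Q (s + i) g ≠ₛ Q i g) ≡ distance i s + 𝟙 (Q (suc s + i) g ≠ₛ Q i g)
  distance-update i s {g} same = ∑-update g λ f f≢g → cong (λ x → 𝟙 (x ≠ₛ Q i f)) (same f f≢g)

  distance-suc : ∀ i s → distance i (suc s) ≤ suc (distance i s)
  distance-suc i s with unchanged-or-flip (s + i)
  ... | inj₁ unchanged =
    ≤-trans (≤-reflexive (sum-cong-≗ λ f → cong (λ x → 𝟙 (x ≠ₛ Q i f)) (unchanged f))) (n≤1+n _)
  ... | inj₂ (g , flipped) = begin
    distance i (suc s)                                 ≤⟨ m≤m+n _ _ ⟩
    distance i (suc s) + 𝟙 (Q (s + i) g ≠ₛ Q i g)       ≡⟨ distance-update i s (λ f → Q-local (s + i) flipped) ⟩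
    distance i s + 𝟙 (Q (suc s + i) g ≠ₛ Q i g)         ≤⟨ +-monoʳ-≤ (distance i s) (𝟙≤1 _) ⟩
    distance i s + 1                                   ≡⟨ +-comm (distance i s) 1 ⟩
    suc (distance i s)                                 ∎
    where open ≤-Reasoning

  distance-+ : ∀ i r s → distance i (r + s) ≤ r + distance i s
  distance-+ i zero s = ≤-refl
  distance-+ i (suc r) s = ≤-trans (distance-suc i (r + s)) (s≤s (distance-+ i r s))

  distance-exact : ∀ i s → s ≤ m → distance i s ≡ s
  distance-exact i s s≤m = ≤-antisym upper lower
    where
    upper : distance i s ≤ s
    upper = begin
      distance i s        ≡⟨ cong (distance i) (+-identityʳ s) ⟨
      distance i (s + 0)  ≤⟨ distance-+ i s 0 ⟩
      s + distance i 0    ≡⟨ cong (s +_) (distance-zero i) ⟩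
      s + 0               ≡⟨ +-identityʳ s ⟩
      s                   ∎
      where open ≤-Reasoning
    lower : s ≤ distance i s
    lower = +-cancelˡ-≤ (m ∸ s) s (distance i s) (begin
      m ∸ s + s               ≡⟨ m∸n+n≡m s≤m ⟩
      m                       ≡⟨ distance-half i ⟨
      distance i m            ≡⟨ cong (distance i) (m∸n+n≡m s≤m) ⟨
      distance i (m ∸ s + s)  ≤⟨ distance-+ i (m ∸ s) s ⟩
      m ∸ s + distance i s    ∎)
      where open ≤-Reasoning

  step-flips : ∀ k → ∃ λ g → Q k g ≢ Q (suc k) g
  step-flips k with unchanged-or-flip k
  ... | inj₂ flip = flip
  ... | inj₁ unchanged =
    ⊥-elim (0≢1+n (trans (sym (∑-𝟙-none (≠ₛ-false ∘ unchanged))) (distance-exact k 1 (>-nonZero⁻¹ m))))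

  flip : ℕ → Fin m
  flip k = proj₁ (step-flips k)

  flip-changes : ∀ k → Q k (flip k) ≢ Q (suc k) (flip k)
  flip-changes k = proj₂ (step-flips k)

  flip-reverses : ∀ k → Q k (flip k) ≡ negS (Q (suc k) (flip k))
  flip-reverses k = ≢⇒opposite (Q-nonzero k (flip k)) (Q-nonzero (suc k) (flip k)) (flip-changes k)

  -- Flipping an element back would decrease the distance from Q i, which grows at every step.
  flips-are-fresh : ∀ i s → s < m → ∀ {g} → Q (s + i) g ≢ Q (suc s + i) g → Q (s + i) g ≡ Q i g
  flips-are-fresh i s s<m {g} flipped with Q (s + i) g ≟ₛ Q i g
  ... | yes fresh = fresh
  ... | no stale = ⊥-elim (m≢1+m+n s (begin
    s
      ≡⟨ +-identityʳ s ⟨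
    s + 0
      ≡⟨ cong₂ _+_ (distance-exact i s (<⇒≤ s<m)) (cong 𝟙 (≠ₛ-false back)) ⟨
    distance i s + 𝟙 (Q (suc s + i) g ≠ₛ Q i g)
      ≡⟨ distance-update i s (λ f → Q-local (s + i) flipped) ⟨
    distance i (suc s) + 𝟙 (Q (s + i) g ≠ₛ Q i g)
      ≡⟨ cong₂ _+_ (distance-exact i (suc s) s<m) (cong 𝟙 (≠ₛ-true stale)) ⟩
    suc s + 1
      ∎))
    where
    open ≡-Reasoning
    back : Q (suc s + i) g ≡ Q i g
    back = begin
      Q (suc s + i) g              ≡⟨ ≢⇒opposite (Q-nonzero _ g) (Q-nonzero _ g) (flipped ∘ sym) ⟩
      negS (Q (s + i) g)           ≡⟨ cong negS (≢⇒opposite (Q-nonzero _ g) (Q-nonzero i g) stale) ⟩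
      negS (negS (Q i g))          ≡⟨ negS-involutive (Q i g) ⟩
      Q i g                        ∎

  stays-flipped : ∀ i {e} → Q i e ≢ Q (suc i) e → ∀ s → s < m → Q (suc s + i) e ≡ Q (suc i) e
  stays-flipped i flipped zero _ = refl
  stays-flipped i {e} flipped (suc s) ss<m = trans unchanged still
    where
    still : Q (suc s + i) e ≡ Q (suc i) e
    still = stays-flipped i flipped s (<-trans (n<1+n s) ss<m)
    unchanged : Q (suc (suc s) + i) e ≡ Q (suc s + i) e
    unchanged = decidable-stable (_ ≟ₛ _) λ changed →
      flipped (trans (sym (flips-are-fresh i (suc s) ss<m (changed ∘ sym))) still)

  flip-antipodal : ∀ k → flip (k + m) ≡ flip k
  flip-antipodal k = decidable-stable (flip (k + m) Fin.≟ flip k) λ g≢flip →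
    flip-changes (k + m) (begin
      Q (k + m) g           ≡⟨ Q-antipodal k g ⟩
      negS (Q k g)          ≡⟨ cong negS (Q-local k (flip-changes k) g≢flip) ⟨
      negS (Q (suc k) g)    ≡⟨ Q-antipodal (suc k) g ⟨
      Q (suc k + m) g       ∎)
    where
    open ≡-Reasoning
    g = flip (k + m)

  raises : ℕ → Bool
  raises k = isPlus (Q (suc k) (flip k))

  raises-antipodal : ∀ k → raises (k + m) ≡ not (raises k)
  raises-antipodal k = begin
    isPlus (Q (suc k + m) (flip (k + m)))   ≡⟨ cong (isPlus ∘ Q (suc k + m)) (flip-antipodal k) ⟩
    isPlus (Q (suc k + m) (flip k))         ≡⟨ cong isPlus (Q-antipodal (suc k) (flip k)) ⟩
    isPlus (negS (Q (suc k) (flip k)))      ≡⟨ isPlus-negS (Q-nonzero (suc k) (flip k)) ⟩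
    not (raises k)                          ∎
    where open ≡-Reasoning

  raises-periodic : ∀ k → raises (k + n) ≡ raises k
  raises-periodic = antipodal⇒periodic {inv = not} not-involutive raises raises-antipodal

  raising-step : ∀ k → raises k ≡ true → Q k ⊆⁺ Q (suc k) × ¬ (Q (suc k) ⊆⁺ Q k)
  raising-step k raised = raising-one-entry (λ f → Q-local k (flip-changes k)) before after
    where
    after = isPlus⇒≡⊕ raised
    before = trans (flip-reverses k) (cong negS after)

  lowering-step : ∀ k → raises k ≡ false → Q (suc k) ⊆⁺ Q k × ¬ (Q k ⊆⁺ Q (suc k))
  lowering-step k lowered = raising-one-entry (λ f f≢g → sym (Q-local k (flip-changes k) f≢g)) after before
    where
    after = ¬isPlus⇒≡⊖ (Q-nonzero (suc k) (flip k)) lowered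
    before = trans (flip-reverses k) (cong negS after)

  -- peak k and valley k describe the tope Q (suc k), entered by step k and left by step suc k.
  peak : ℕ → Bool
  peak k = raises k ∧ not (raises (suc k))

  valley : ℕ → Bool
  valley k = not (raises k) ∧ raises (suc k)

  beyond-half : ∀ {t} → m ≤ t → suc t < n → ∃ λ s → suc s < m × t ≡ m + s
  beyond-half {t} m≤t st<n = t ∸ m , +-cancelˡ-< m _ _ (begin-strict
    m + suc (t ∸ m)   ≡⟨ +-suc m (t ∸ m) ⟩
    suc (m + (t ∸ m)) ≡⟨ cong suc (m+[n∸m]≡n m≤t) ⟩
    suc t             <⟨ st<n ⟩
    n                 ≡⟨ n≡m+m ⟩
    m + m             ∎) , sym (m+[n∸m]≡n m≤t)
    where open ≤-Reasoning

  flipped-back : ∀ k {a} → Q k a ≢ Q (suc k) a → ∀ s → suc s < m →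
                 Q (suc (m + s) + suc k) a ≡ negS (Q (suc k) a)
  flipped-back k {a} flipped s ss<m = begin
    Q (suc (m + s) + suc k) a      ≡⟨ cong (λ j → Q j a) (index m s k) ⟩
    Q (suc (suc s) + k + m) a      ≡⟨ Q-antipodal (suc (suc s) + k) a ⟩
    negS (Q (suc (suc s) + k) a)   ≡⟨ cong negS (stays-flipped k flipped (suc s) ss<m) ⟩
    negS (Q (suc k) a)             ∎
    where
    open ≡-Reasoning
    index : ∀ m s k → suc (m + s) + suc k ≡ suc (suc s) + k + m
    index = solve-∀

  peak-maximal : ∀ k → raises k ≡ true → raises (suc k) ≡ false →
                 ∀ t → t < n → Q (suc k) ⊆⁺ Q (t + suc k) → t ≡ 0
  peak-maximal k _ _ zero _ _ = refl
  peak-maximal k raised lowered (suc t) st<n dominated with t <? m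
  ... | yes t<m = ⊥-elim (⊕≢⊖ (trans (sym (dominated b b-now)) b-later))
    where
    b = flip (suc k)
    b-after = ¬isPlus⇒≡⊖ (Q-nonzero (suc (suc k)) b) lowered
    b-now = trans (flip-reverses (suc k)) (cong negS b-after)
    b-later = trans (stays-flipped (suc k) (flip-changes (suc k)) t t<m) b-after
  ... | no t≮m with beyond-half (≮⇒≥ t≮m) st<n
  ... | s , ss<m , refl = ⊥-elim (⊕≢⊖ (trans (sym (dominated a a-now)) a-later))
    where
    a = flip k
    a-now = isPlus⇒≡⊕ raised
    a-later = trans (flipped-back k (flip-changes k) s ss<m) (cong negS a-now)

  module _ (e : Fin m) where
    plus : ℕ → Bool
    plus k = isPlus (Q k e)

    rise : ℕ → Bool
    rise k = not (plus k) ∧ plus (suc k)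

    plus-antipodal : ∀ k → plus (k + m) ≡ not (plus k)
    plus-antipodal k = trans (cong isPlus (Q-antipodal k e)) (isPlus-negS (Q-nonzero k e))

    plus-periodic : ∀ k → plus (k + n) ≡ plus k
    plus-periodic = antipodal⇒periodic {inv = not} not-involutive plus plus-antipodal

    rise-periodic : ∀ k → rise (k + n) ≡ rise k
    rise-periodic k rewrite plus-periodic k | plus-periodic (suc k) = refl

    plus-steady-or-flipped : ∀ k → plus (suc k) ≡ plus k ⊎ raises k ≡ plus (suc k)
    plus-steady-or-flipped k with e Fin.≟ flip k
    ... | yes refl = inj₂ refl
    ... | no e≢flip = inj₁ (cong isPlus (Q-local k (flip-changes k) e≢flip))

    rise-exists : ∃ λ k → rise k ≡ true
    rise-exists with plus 0 in p₀
    ... | false = discrete-ivt plus m p₀ (trans (plus-antipodal 0) (cong not p₀))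
    ... | true with k , r ← discrete-ivt (λ k → plus (k + m)) m
                               (trans (plus-antipodal 0) (cong not p₀))
                               (trans (plus-antipodal m) (cong not (trans (plus-antipodal 0) (cong not p₀))))
                  = k + m , r

    rise-flips : ∀ {k} → rise k ≡ true → Q k e ≢ Q (suc k) e
    rise-flips risen same with before , after ← not-∧-true risen =
      false≢true (trans (sym before) (trans (cong isPlus same) after))

    plus-after-rise : ∀ {k} → rise k ≡ true → ∀ s → s < m → plus (suc s + k) ≡ true
    plus-after-rise risen s s<m =
      trans (cong isPlus (stays-flipped _ (rise-flips risen) s s<m)) (proj₂ (not-∧-true risen))

    minus-after-half : ∀ {k} → rise k ≡ true → ∀ s → suc s < m → plus (suc (m + s) + suc k) ≡ false
    minus-after-half {k} risen s ss<m = begin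
      isPlus (Q (suc (m + s) + suc k) e)   ≡⟨ cong isPlus (flipped-back k (rise-flips risen) s ss<m) ⟩
      isPlus (negS (Q (suc k) e))          ≡⟨ isPlus-negS (Q-nonzero (suc k) e) ⟩
      not (plus (suc k))                   ≡⟨ cong not (proj₂ (not-∧-true risen)) ⟩
      false                                ∎
      where open ≡-Reasoning

    rise-isolated : ∀ {k} → rise k ≡ true → ∀ t → suc t < n → rise (suc t + k) ≡ false
    rise-isolated {k} risen t st<n with t <? m
    ... | yes t<m = cong (λ x → not x ∧ plus (suc (suc t + k))) (plus-after-rise risen t t<m)
    ... | no t≮m with beyond-half (≮⇒≥ t≮m) st<n
    ... | s , ss<m , refl = trans (cong (not (plus (suc (m + s) + k)) ∧_) later) (∧-zeroʳ _)
      where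
      later : plus (suc (suc (m + s) + k)) ≡ false
      later = trans (cong plus (sym (+-suc (suc (m + s)) k))) (minus-after-half risen s ss<m)

    rises-once : sumUpTo n (𝟙 ∘ rise) ≡ 1
    rises-once with k , risen ← rise-exists = begin
      sumUpTo n (𝟙 ∘ rise)                 ≡⟨ sumUpTo-shift n (𝟙 ∘ rise) (cong 𝟙 ∘ rise-periodic) k ⟨
      sumUpTo n (λ t → 𝟙 (rise (t + k)))   ≡⟨ sumUpTo-𝟙-single n (λ t → rise (t + k)) (>-nonZero⁻¹ n) risen
                                                               (rise-isolated risen) ⟩
      1                                    ∎
      where open ≡-Reasoning

    peak⁺ valley⁺ peak⁻ : ℕ → ℕ
    peak⁺ k = 𝟙 (peak k ∧ plus (suc k))
    valley⁺ k = 𝟙 (valley k ∧ plus (suc k))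
    peak⁻ k = 𝟙 (peak k ∧ not (plus (suc k)))

    peaks⁺≡1+valleys⁺ : sumUpTo n peak⁺ ≡ suc (sumUpTo n valley⁺)
    -- Over a period the w-terms telescope away, leaving the single rise of e.
    peaks⁺≡1+valleys⁺ = +-cancelʳ-≡ (sumUpTo n w) _ _ (begin
      sumUpTo n peak⁺ + sumUpTo n w
        ≡⟨ cong (sumUpTo n peak⁺ +_) (sumUpTo-rotate n w w-periodic) ⟨
      sumUpTo n peak⁺ + sumUpTo n (w ∘ suc)
        ≡⟨ sumUpTo-distrib-+ n peak⁺ (w ∘ suc) ⟨
      sumUpTo n (λ k → peak⁺ k + w (suc k))
        ≡⟨ sumUpTo-cong n (λ k _ → telescope k) ⟩
      sumUpTo n (λ k → valley⁺ k + w k + 𝟙 (rise k))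
        ≡⟨ sumUpTo-distrib-+ n (λ k → valley⁺ k + w k) (𝟙 ∘ rise) ⟩
      sumUpTo n (λ k → valley⁺ k + w k) + sumUpTo n (𝟙 ∘ rise)
        ≡⟨ cong₂ _+_ (sumUpTo-distrib-+ n valley⁺ w) rises-once ⟩
      sumUpTo n valley⁺ + sumUpTo n w + 1
        ≡⟨ +-comm _ 1 ⟩
      suc (sumUpTo n valley⁺ + sumUpTo n w)
        ∎)
      where
      open ≡-Reasoning
      w : ℕ → ℕ
      w k = 𝟙 (raises k ∧ plus k)
      w-periodic : w n ≡ w 0
      w-periodic = cong 𝟙 (cong₂ _∧_ (raises-periodic 0) (plus-periodic 0))
      telescope : ∀ k → peak⁺ k + w (suc k) ≡ valley⁺ k + w k + 𝟙 (rise k)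
      telescope k =
        telescope-step (raises k) (raises (suc k)) (plus k) (plus (suc k)) (plus-steady-or-flipped k)

    peaks⁻≡valleys⁺ : sumUpTo n peak⁻ ≡ sumUpTo n valley⁺
    peaks⁻≡valleys⁺ = begin
      sumUpTo n peak⁻                      ≡⟨ sumUpTo-shift n peak⁻ peak⁻-periodic m ⟨
      sumUpTo n (λ k → peak⁻ (k + m))      ≡⟨ sumUpTo-cong n (λ k _ → antipode k) ⟩
      sumUpTo n valley⁺                    ∎
      where
      open ≡-Reasoning
      peak⁻-periodic : ∀ k → peak⁻ (k + n) ≡ peak⁻ k
      peak⁻-periodic k rewrite raises-periodic k | raises-periodic (suc k) | plus-periodic (suc k) = refl
      antipode : ∀ k → peak⁻ (k + m) ≡ valley⁺ k
      antipode k rewrite raises-antipodal k | raises-antipodal (suc k) | plus-antipodal (suc k)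
                       | not-involutive (raises (suc k)) | not-involutive (plus (suc k)) = refl

    peaks⁺≡⌈peaks/2⌉ : sumUpTo n peak⁺ ≡ ⌈ sumUpTo n (𝟙 ∘ peak) /2⌉
    peaks⁺≡⌈peaks/2⌉ = begin
      sumUpTo n peak⁺                           ≡⟨ peaks⁺≡1+valleys⁺ ⟩
      suc v                                     ≡⟨ cong suc (n≡⌊n+n/2⌋ v) ⟩
      ⌈ suc v + v /2⌉                           ≡⟨ cong ⌈_/2⌉ (cong₂ _+_ peaks⁺≡1+valleys⁺ peaks⁻≡valleys⁺) ⟨
      ⌈ sumUpTo n peak⁺ + sumUpTo n peak⁻ /2⌉   ≡⟨ cong ⌈_/2⌉ (sumUpTo-distrib-+ n peak⁺ peak⁻) ⟨
      ⌈ sumUpTo n (λ k → peak⁺ k + peak⁻ k) /2⌉ ≡⟨ cong ⌈_/2⌉ (sumUpTo-cong n λ k _ → split k) ⟨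
      ⌈ sumUpTo n (𝟙 ∘ peak) /2⌉                ∎
      where
      open ≡-Reasoning
      v = sumUpTo n valley⁺
      split : ∀ k → 𝟙 (peak k) ≡ peak⁺ k + peak⁻ k
      split k = 𝟙-split (peak k) (plus (suc k))

-- Symmetric cycles

module SymmetricCycleWalk {m} {{_ : NonZero m}} {L : SignVec m → Set} (om : IsOM m L) (simple : Simple L)
  {R : ℕ → SignVec m} (cycle : SymmetricCycle m L R) where

  private
    n : ℕ
    n = 2 * m
    instance
      n≢0 : NonZero n
      n≢0 = m*n≢0 2 m
    R-tope = proj₁ cycle
    R-adjacent = proj₁ (proj₂ cycle)
    R-closes = proj₁ (proj₂ (proj₂ cycle))
    R-antipodal = proj₂ (proj₂ (proj₂ (proj₂ cycle)))

  Q : ℕ → SignVec m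
  Q k = R (k % n)

  Q-tope : ∀ k → IsTope L (Q k)
  Q-tope k = R-tope (k % n) (m%n<n k n)

  R-suc-mod : ∀ k → R (suc (k % n)) ≡ Q (suc k)
  R-suc-mod k with m≤n⇒m<n∨m≡n (m%n<n k n)
  ... | inj₁ 1+r<n = cong R (sym (trans (suc-%-suc k n) (m<n⇒m%n≡m 1+r<n)))
  ... | inj₂ 1+r≡n = begin
    R (suc (k % n))  ≡⟨ cong R 1+r≡n ⟩
    R n              ≡⟨ R-closes ⟩
    R 0              ≡⟨ cong R (trans (trans (suc-%-suc k n) (cong (_% n) 1+r≡n)) (n%n≡0 n)) ⟨
    Q (suc k)        ∎
    where open ≡-Reasoning

  Q-adjacent : ∀ k → Adjacent L (Q k) (Q (suc k))
  Q-adjacent k = subst (Adjacent L (Q k)) (R-suc-mod k) (R-adjacent (k % n) (m%n<n k n))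

  Q-antipodal : ∀ k f → Q (k + m) f ≡ negS (Q k f)
  Q-antipodal k f with k % n <? m
  ... | yes r<m = begin
    R ((k + m) % n) f      ≡⟨ cong (λ j → R j f) (trans (sym ([m%d+n]%d≡[m+n]%d k m n)) (m<n⇒m%n≡m r+m<n)) ⟩
    R (k % n + m) f        ≡⟨ cong-app (R-antipodal (k % n) r<m) f ⟩
    negS (R (k % n) f)     ∎
    where
    open ≡-Reasoning
    r+m<n : k % n + m < n
    r+m<n = subst (k % n + m <_) (sym (2*m≡m+m m)) (+-monoˡ-< m r<m)
  ... | no r≮m = begin
    R ((k + m) % n) f          ≡⟨ cong (λ j → R j f) (trans (sym ([m%d+n]%d≡[m+n]%d k m n)) r+m≡s) ⟩
    R s f                      ≡⟨ negS-involutive (R s f) ⟨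
    negS (negS (R s f))        ≡⟨ cong negS (cong-app (R-antipodal s s<m) f) ⟨
    negS (R (s + m) f)         ≡⟨ cong (λ j → negS (R j f)) s+m≡r ⟩
    negS (R (k % n) f)         ∎
    where
    open ≡-Reasoning
    s = k % n ∸ m
    s+m≡r : s + m ≡ k % n
    s+m≡r = m∸n+n≡m (≮⇒≥ r≮m)
    s<m : s < m
    s<m = +-cancelʳ-< m s m (subst (_< m + m) (sym s+m≡r) (subst (k % n <_) (2*m≡m+m m) (m%n<n k n)))
    r+m≡s : (k % n + m) % n ≡ s
    r+m≡s = begin
      (k % n + m) % n   ≡⟨ cong (λ x → (x + m) % n) s+m≡r ⟨
      (s + m + m) % n   ≡⟨ cong (_% n) (trans (+-assoc s m m) (cong (s +_) (sym (2*m≡m+m m)))) ⟩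
      (s + n) % n       ≡⟨ [m+n]%n≡m%n s n ⟩
      s % n             ≡⟨ m<n⇒m%n≡m (<-trans s<m (subst (m <_) (sym (2*m≡m+m m)) (m<m+n m (>-nonZero⁻¹ m)))) ⟩
      s                 ∎

  open AntipodalWalk Q (λ k → tope-nonzero om simple (Q-tope k))
                       (λ k → adjacent-differ-once om simple (Q-adjacent k)) Q-antipodal
    public using (raises; peak; peak⁺; raising-step; lowering-step; peak-maximal; peaks⁺≡⌈peaks/2⌉)

  inMaxPlus-peak : ∀ k → inMaxPlus m R (suc k % n) ≡ peak k
  inMaxPlus-peak k with raises k in raised | raises (suc k) in raised′
  ... | false | _ = inMaxPlus-false m R _ (m%n<n k n)
                       (proj₁ (lowering-step k raised)) (proj₂ (lowering-step k raised))
  ... | true | true = inMaxPlus-false m R _ (m%n<n (suc (suc k)) n)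
                        (proj₁ (raising-step (suc k) raised′)) (proj₂ (raising-step (suc k) raised′))
  ... | true | false = inMaxPlus-true m R _ maximal
    where
    maximal : ∀ j → j < n → Q (suc k) ⊆⁺ R j → R j ⊆⁺ Q (suc k)
    maximal j j<n Q⊆Rj with t , t<n , t+c≡j ← cyclic-offset n (suc k) j j<n
      with refl ← peak-maximal k raised raised′ t t<n (subst (λ i → Q (suc k) ⊆⁺ R i) (sym t+c≡j) Q⊆Rj)
      = subst (λ i → R i ⊆⁺ Q (suc k)) t+c≡j (λ _ Rf≡⊕ → Rf≡⊕)

  sizeB≡peaks : sizeB m R ≡ sumUpTo n (𝟙 ∘ peak)
  sizeB≡peaks = begin
    count (inMaxPlus m R) (upTo n)                     ≡⟨ count-applyUpTo (inMaxPlus m R) id n ⟩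
    sumUpTo n (𝟙 ∘ inMaxPlus m R)                      ≡⟨ sumUpTo-rotate-% n (𝟙 ∘ inMaxPlus m R) ⟩
    sumUpTo n (λ k → 𝟙 (inMaxPlus m R (suc k % n)))    ≡⟨ sumUpTo-cong n (λ k _ → cong 𝟙 (inMaxPlus-peak k)) ⟩
    sumUpTo n (𝟙 ∘ peak)                               ∎
    where open ≡-Reasoning

  sizeBplus≡peaks⁺ : ∀ e → sizeBplus m R e ≡ sumUpTo n (peak⁺ e)
  sizeBplus≡peaks⁺ e = begin
    count in-B⁺ (upTo n)                                                    ≡⟨ count-applyUpTo in-B⁺ id n ⟩
    sumUpTo n (𝟙 ∘ in-B⁺)                                                   ≡⟨ sumUpTo-rotate-% n (𝟙 ∘ in-B⁺) ⟩
    sumUpTo n (λ k → 𝟙 (inMaxPlus m R (suc k % n) ∧ isPlus (Q (suc k) e)))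
      ≡⟨ sumUpTo-cong n (λ k _ → cong (λ b → 𝟙 (b ∧ isPlus (Q (suc k) e))) (inMaxPlus-peak k)) ⟩
    sumUpTo n (peak⁺ e)                                                     ∎
    where
    open ≡-Reasoning
    in-B⁺ : ℕ → Bool
    in-B⁺ k = inMaxPlus m R k ∧ isPlus (R k e)

mainTheorem6 : (m : ℕ) (L : SignVec m → Set) → IsOM m L → RankAtLeast2 L → Simple L →
    (R : ℕ → SignVec m) → SymmetricCycle m L R →
    (∀ k → k < 2 * m → R k ≢ plusV) →
    ∀ (e : Fin m) → sizeBplus m R e ≡ ⌈ sizeB m R /2⌉
mainTheorem6 zero _ _ _ _ _ _ _ ()
mainTheorem6 m@(suc _) L om _ simple R cycle _ e = begin
  sizeBplus m R e              ≡⟨ sizeBplus≡peaks⁺ e ⟩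
  sumUpTo (2 * m) (peak⁺ e)    ≡⟨ peaks⁺≡⌈peaks/2⌉ e ⟩
  ⌈ sumUpTo (2 * m) (𝟙 ∘ peak) /2⌉ ≡⟨ cong ⌈_/2⌉ sizeB≡peaks ⟨
  ⌈ sizeB m R /2⌉              ∎
  where
  open ≡-Reasoning
  open SymmetricCycleWalk om simple cycle
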